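{- For every integer $k \ge 1$, the word $\langle \mathrm{sat}(k)\rangle$ is the unique admissible word of length $k$ all of whose digits lie in $\{1,2\}$.
   Context: Every $n \in \mathbb N=\{0,1,2,\dots\}$ has a unique expression $n = \frac12\sum_{i=0}^k a_i (3/2)^i$ with digits $a_i \in \{0,1,2\}$ and $a_k \neq 0$ if $n \ge 1$; its representation in rational base $3/2$ is the word $\langle n\rangle = a_k\cdots a_0 \in \{0,1,2\}^*$ (so it has no leading zero), with $\langle 0\rangle$ the empty word. A word is admissible if it equals $\langle n\rangle$ for some $n\in\mathbb N$. $|w|$ denotes the length of a word $w$. For $k \ge 1$, $\mathrm{sat}(k) = \max\{n \in \mathbb N : |\langle n\rangle| = k\}$. -}

module Defs where

open import Data.Nat using (ℕ; suc; _*_; _≤_; _/_)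
open import Data.Nat.DivMod using (_mod_)
open import Data.Fin using (Fin; zero)
open import Data.Empty using (⊥)
open import Data.List using (List; []; _∷_; reverse; length)
open import Data.Product using (Σ; _×_)
open import Relation.Binary.PropositionalEquality using (_≡_)

Digit : Set
Digit = Fin 3

-- Words, written most-significant digit first: a_k ⋯ a_0
Word : Set
Word = List Digit

-- Least-significant-digit-first expansion with fuel.
-- n = ½ Σ a_i (3/2)^i  ⇔  2n = 3m + a_0 with m = ½ Σ a_{i+1} (3/2)^i,
-- so a_0 = 2n mod 3 and the remaining digits represent m = 2n / 3 (< n for n ≥ 1).
-- Fuel n is enough since the value strictly decreases.
repRevAux : ℕ → ℕ → Word
repRevAux ℕ.zero    _       = []
repRevAux (suc f) ℕ.zero    = []
repRevAux (suc f) (suc n) = ((2 * suc n) mod 3) ∷ repRevAux f ((2 * suc n) / 3)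

⟨_⟩ : ℕ → Word
⟨ n ⟩ = reverse (repRevAux n n)

Admissible : Word → Set
Admissible w = Σ ℕ (λ n → ⟨ n ⟩ ≡ w)

IsSat : ℕ → ℕ → Set
IsSat k n = (length ⟨ n ⟩ ≡ k) × (∀ m → length ⟨ m ⟩ ≡ k → m ≤ n)

NonZeroDigit : Digit → Set
NonZeroDigit d = d ≡ zero → ⊥

{-# OPTIONS --safe #-}
module Submission where

-- Read from the least significant end, the word of n ≥ 1 is the word of q followed by the
-- digit r, where 2n = r + 3q.  So if n has at most k digits then q ≤ sat (k - 1) and
-- 2n ≤ 3 sat (k - 1) + 2, i.e. n ≤ sat k := ⌊(3 sat (k - 1) + 2) / 2⌋; if moreover all digits
-- are nonzero then 2n ≥ 1 + 3 sat (k - 1), which forces n ≥ sat k.  Finally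
-- 2 sat k - 3 sat (k - 1) ∈ {1, 2} is the last digit of sat k, so its digits are all nonzero.

open import Defs
open import Data.Nat using (ℕ; zero; suc; _+_; _*_; _/_; _%_; _≤_; _<_; z≤n; s≤s; s≤s⁻¹; NonZero)
open import Data.Nat.Properties
open import Data.Nat.DivMod using (module DivMod; _divMod_; _mod_; m≡m%n+[m/n]*n; m%n<n; m<n⇒m%n≡m; [m+kn]%n≡m%n; m<n*o⇒m/o<n)
open import Data.Fin using (Fin; toℕ)
open import Data.Fin.Patterns using (0F; 1F; 2F)
open import Data.Fin.Properties using (toℕ-fromℕ<; toℕ-injective; toℕ<n; toℕ≤pred[n])
open import Data.List using (_∷_; length; reverse)
open import Data.List.Properties using (length-reverse)
open import Data.List.Relation.Unary.All using (All; []; _∷_)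
open import Data.List.Relation.Binary.Permutation.Propositional using (↭-sym)
open import Data.List.Relation.Binary.Permutation.Propositional.Properties using (All-resp-↭; ↭-reverse)
open import Data.Product using (Σ; _×_; _,_; proj₁; proj₂)
open import Data.Empty using (⊥-elim)
open import Relation.Binary.PropositionalEquality

divMod-unique : ∀ {m q d} .{{_ : NonZero d}} (r : Fin d) →
                m ≡ toℕ r + q * d → m mod d ≡ r × m / d ≡ q
divMod-unique {m} {q} {d} r m≡r+qd =
  m-mod-d≡r , *-cancelʳ-≡ (m / d) q d (+-cancelˡ-≡ (toℕ r) _ _ r+[m/d]d≡r+qd)
  where
  m%d≡r : m % d ≡ toℕ r
  m%d≡r = begin
    m % d                 ≡⟨ cong (_% d) m≡r+qd ⟩
    (toℕ r + q * d) % d   ≡⟨ [m+kn]%n≡m%n (toℕ r) q d ⟩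
    toℕ r % d             ≡⟨ m<n⇒m%n≡m (toℕ<n r) ⟩
    toℕ r                 ∎
    where open ≡-Reasoning
  m-mod-d≡r : m mod d ≡ r
  m-mod-d≡r = toℕ-injective (trans (toℕ-fromℕ< (m%n<n m d)) m%d≡r)
  r+[m/d]d≡r+qd : toℕ r + m / d * d ≡ toℕ r + q * d
  r+[m/d]d≡r+qd = trans (cong (_+ m / d * d) (sym m%d≡r)) (trans (sym (m≡m%n+[m/n]*n m d)) m≡r+qd)

⟨_⟩ʳ : ℕ → Word
⟨ n ⟩ʳ = repRevAux n n

2[1+n]/3≤n : ∀ n → 2 * suc n / 3 ≤ n
2[1+n]/3≤n n = s≤s⁻¹ (m<n*o⇒m/o<n 2[1+n]<[1+n]3)
  where
  2[1+n]<[1+n]3 : 2 * suc n < suc n * 3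
  2[1+n]<[1+n]3 = subst (_< suc n * 3) (*-comm (suc n) 2) (*-monoʳ-< (suc n) (s≤s (s≤s (s≤s z≤n))))

repRevAux-fuel : ∀ {f g} n → n ≤ f → n ≤ g → repRevAux f n ≡ repRevAux g n
repRevAux-fuel {zero}  {zero}  zero    _         _         = refl
repRevAux-fuel {zero}  {suc _} zero    _         _         = refl
repRevAux-fuel {suc _} {zero}  zero    _         _         = refl
repRevAux-fuel {suc _} {suc _} zero    _         _         = refl
repRevAux-fuel {suc f} {suc g} (suc n) (s≤s n≤f) (s≤s n≤g) =
  cong (_ ∷_) (repRevAux-fuel (2 * suc n / 3) (≤-trans (2[1+n]/3≤n n) n≤f) (≤-trans (2[1+n]/3≤n n) n≤g))

⟨suc⟩ʳ : ∀ n → ⟨ suc n ⟩ʳ ≡ (2 * suc n) mod 3 ∷ ⟨ 2 * suc n / 3 ⟩ʳ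
⟨suc⟩ʳ n = cong ((2 * suc n) mod 3 ∷_) (repRevAux-fuel (2 * suc n / 3) (2[1+n]/3≤n n) ≤-refl)

⟨⟩ʳ-step : ∀ {n q} (r : Digit) → NonZeroDigit r → 2 * n ≡ toℕ r + q * 3 → ⟨ n ⟩ʳ ≡ r ∷ ⟨ q ⟩ʳ
⟨⟩ʳ-step {zero}  0F r≢0 _ = ⊥-elim (r≢0 refl)
⟨⟩ʳ-step {zero}  1F _   ()
⟨⟩ʳ-step {zero}  2F _   ()
⟨⟩ʳ-step {suc n} r  _   2n≡r+3q with divMod-unique r 2n≡r+3q
... | mod≡r , div≡q = trans (⟨suc⟩ʳ n) (cong₂ (λ d m → d ∷ ⟨ m ⟩ʳ) mod≡r div≡q)

sat : ℕ → ℕ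
sat zero    = 0
sat (suc k) = (2 + sat k * 3) / 2

sat-suc : ∀ k → Σ Digit λ r → NonZeroDigit r × 2 * sat (suc k) ≡ toℕ r + sat k * 3
sat-suc k with (2 + sat k * 3) % 2 | m%n<n (2 + sat k * 3) 2 | m≡m%n+[m/n]*n (2 + sat k * 3) 2
... | 0 | _ | 2+3s≡2s′ = 2F , (λ ()) , trans (*-comm 2 (sat (suc k))) (sym 2+3s≡2s′)
... | 1 | _ | 2+3s≡1+2s′ = 1F , (λ ()) , trans (*-comm 2 (sat (suc k))) (sym (suc-injective 2+3s≡1+2s′))
... | suc (suc _) | s≤s (s≤s ()) | _

nonZeroDigit⇒1≤toℕ : ∀ {r} → NonZeroDigit r → 1 ≤ toℕ r
nonZeroDigit⇒1≤toℕ {0F} r≢0 = ⊥-elim (r≢0 refl)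
nonZeroDigit⇒1≤toℕ {1F} _   = s≤s z≤n
nonZeroDigit⇒1≤toℕ {2F} _   = s≤s z≤n

1+3sat≤2sat[1+k] : ∀ k → 1 + sat k * 3 ≤ 2 * sat (suc k)
1+3sat≤2sat[1+k] k with sat-suc k
... | r , r≢0 , 2s′≡r+3s =
  ≤-trans (+-monoˡ-≤ (sat k * 3) (nonZeroDigit⇒1≤toℕ r≢0)) (≤-reflexive (sym 2s′≡r+3s))

2sat[1+k]≤2+3sat : ∀ k → 2 * sat (suc k) ≤ 2 + sat k * 3
2sat[1+k]≤2+3sat k with sat-suc k
... | r , _ , 2s′≡r+3s = ≤-trans (≤-reflexive 2s′≡r+3s) (+-monoˡ-≤ (sat k * 3) (toℕ≤pred[n] r))

2m≤1+2n⇒m≤n : ∀ {m n} → 2 * m ≤ 1 + 2 * n → m ≤ n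
2m≤1+2n⇒m≤n {m} {n} 2m≤1+2n =
  s≤s⁻¹ (*-cancelˡ-< 2 m (suc n) (≤-trans (s≤s 2m≤1+2n) (≤-reflexive (sym (*-suc 2 n)))))

length⟨⟩ʳ≤⇒≤sat : ∀ k n → length ⟨ n ⟩ʳ ≤ k → n ≤ sat k
length⟨⟩ʳ≤⇒≤sat _       zero    _  = z≤n
length⟨⟩ʳ≤⇒≤sat zero    (suc n) ()
length⟨⟩ʳ≤⇒≤sat (suc k) (suc n) len≤1+k = 2m≤1+2n⇒m≤n (begin
  2 * suc n            ≡⟨ DivMod.property ((2 * suc n) divMod 3) ⟩
  toℕ r + q * 3        ≤⟨ +-mono-≤ (toℕ≤pred[n] r) (*-monoˡ-≤ 3 q≤sat) ⟩
  2 + sat k * 3        ≤⟨ s≤s (1+3sat≤2sat[1+k] k) ⟩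
  1 + 2 * sat (suc k)  ∎)
  where
  open ≤-Reasoning
  r = (2 * suc n) mod 3
  q = 2 * suc n / 3
  q≤sat : q ≤ sat k
  q≤sat = length⟨⟩ʳ≤⇒≤sat k q (s≤s⁻¹ (subst (λ w → length w ≤ suc k) (⟨suc⟩ʳ n) len≤1+k))

allNonZero⇒sat≤ : ∀ k n → length ⟨ n ⟩ʳ ≡ k → All NonZeroDigit ⟨ n ⟩ʳ → sat k ≤ n
allNonZero⇒sat≤ zero    _       _       _  = z≤n
allNonZero⇒sat≤ (suc k) (suc n) len≡1+k nz with subst (All NonZeroDigit) (⟨suc⟩ʳ n) nz
... | r≢0 ∷ nz′ = 2m≤1+2n⇒m≤n (begin
  2 * sat (suc k)      ≤⟨ 2sat[1+k]≤2+3sat k ⟩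
  2 + sat k * 3        ≤⟨ s≤s (+-mono-≤ (nonZeroDigit⇒1≤toℕ r≢0) (*-monoˡ-≤ 3 sat≤q)) ⟩
  1 + (toℕ r + q * 3)  ≡⟨ cong suc (DivMod.property ((2 * suc n) divMod 3)) ⟨
  1 + 2 * suc n        ∎)
  where
  open ≤-Reasoning
  r = (2 * suc n) mod 3
  q = 2 * suc n / 3
  sat≤q : sat k ≤ q
  sat≤q = allNonZero⇒sat≤ k q (suc-injective (trans (cong length (sym (⟨suc⟩ʳ n))) len≡1+k)) nz′

length×nonZero-⟨sat⟩ʳ : ∀ k → length ⟨ sat k ⟩ʳ ≡ k × All NonZeroDigit ⟨ sat k ⟩ʳ
length×nonZero-⟨sat⟩ʳ zero = refl , []
length×nonZero-⟨sat⟩ʳ (suc k) with sat-suc k | length×nonZero-⟨sat⟩ʳ k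
... | r , r≢0 , 2s′≡r+3s | len≡k , nz =
  subst (λ w → length w ≡ suc k × All NonZeroDigit w)
        (sym (⟨⟩ʳ-step r r≢0 2s′≡r+3s)) (cong suc len≡k , r≢0 ∷ nz)

All-reverse⁺ : ∀ {P : Digit → Set} {w : Word} → All P w → All P (reverse w)
All-reverse⁺ {w = w} = All-resp-↭ (↭-sym (↭-reverse w))

All-reverse⁻ : ∀ {P : Digit → Set} {w : Word} → All P (reverse w) → All P w
All-reverse⁻ {w = w} = All-resp-↭ (↭-reverse w)

proposition11 : ∀ (k : ℕ) → 1 ≤ k →
    Σ ℕ (λ s → IsSat k s
      × (Admissible ⟨ s ⟩ × length ⟨ s ⟩ ≡ k × All NonZeroDigit ⟨ s ⟩)
      × (∀ (w : Word) → Admissible w → length w ≡ k → All NonZeroDigit w → w ≡ ⟨ s ⟩))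
proposition11 k _ =
  sat k , (length⟨sat⟩ , sat-maximal) , ((sat k , refl) , length⟨sat⟩ , All-reverse⁺ nonZero-⟨sat⟩ʳ) , unique
  where
  length⟨⟩≡length⟨⟩ʳ : ∀ n → length ⟨ n ⟩ ≡ length ⟨ n ⟩ʳ
  length⟨⟩≡length⟨⟩ʳ n = length-reverse ⟨ n ⟩ʳ
  length⟨sat⟩ : length ⟨ sat k ⟩ ≡ k
  length⟨sat⟩ = trans (length⟨⟩≡length⟨⟩ʳ (sat k)) (proj₁ (length×nonZero-⟨sat⟩ʳ k))
  nonZero-⟨sat⟩ʳ : All NonZeroDigit ⟨ sat k ⟩ʳ
  nonZero-⟨sat⟩ʳ = proj₂ (length×nonZero-⟨sat⟩ʳ k)
  sat-maximal : ∀ m → length ⟨ m ⟩ ≡ k → m ≤ sat k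
  sat-maximal m len≡k = length⟨⟩ʳ≤⇒≤sat k m (≤-reflexive (trans (sym (length⟨⟩≡length⟨⟩ʳ m)) len≡k))
  unique : ∀ w → Admissible w → length w ≡ k → All NonZeroDigit w → w ≡ ⟨ sat k ⟩
  unique _ (n , refl) len≡k nz = cong ⟨_⟩ (≤-antisym (sat-maximal n len≡k)
    (allNonZero⇒sat≤ k n (trans (sym (length⟨⟩≡length⟨⟩ʳ n)) len≡k) (All-reverse⁻ nz)))
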